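{- Let $G_1=(V_1,E_1)$ and $G_2=(V_2,E_2)$ be graphs. Then $\mathrm{thin}(G_1\ast G_2)\leq \mathrm{indthin}(G_1\ast G_2)\leq \mathrm{indthin}(G_1)|V_2|\leq \mathrm{thin}(G_1)\chi(G_1)|V_2|$ and $\mathrm{pthin}(G_1\ast G_2)\leq \mathrm{indpthin}(G_1\ast G_2)\leq \mathrm{indpthin}(G_1)|V_2|\leq \mathrm{pthin}(G_1)\chi(G_1)|V_2|$.
   Context: Graphs are finite, simple, undirected; $\chi$ is the chromatic number. The co-normal (disjunctive) product $G_1\ast G_2$ has vertex set $V_1\times V_2$, and $(u_1,u_2)$, $(v_1,v_2)$ are adjacent iff $u_1v_1\in E_1$ or $u_2v_2\in E_2$. For a graph $G=(V,E)$, an ordering $v_1,\dots,v_n$ of $V$ and a partition of $V$ are consistent if for every $r<s<t$, whenever $v_r,v_s$ are in the same class and $v_tv_r\in E$, then $v_tv_s\in E$; strongly consistent if moreover for every $r<s<t$, whenever $v_s,v_t$ are in the same class and $v_tv_r\in E$, then $v_sv_r\in E$. $\mathrm{thin}(G)$ (resp. $\mathrm{pthin}(G)$) is the minimum number of classes of a partition of $V$ consistent (resp. strongly consistent) with some ordering of $V$; $\mathrm{indthin}$ (resp. $\mathrm{indpthin}$) is the same minimum when each class is additionally required to be an independent set. -}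

module Defs where

open import Data.Nat using (ℕ; _*_; _≤_; _<_)
open import Data.Fin using (Fin; toℕ; quotient; remainder)
open import Data.Bool using (Bool; true; false; _∨_; T)
open import Data.Product using (Σ; _×_; _,_; ∃)
open import Relation.Binary.PropositionalEquality using (_≡_)
open import Function.Definitions using (Injective)

record Graph : Set where
  field
    size  : ℕ
    edge  : Fin size → Fin size → Bool
    sym   : ∀ u v → edge u v ≡ edge v u
    irrefl : ∀ u → edge u u ≡ false

open Graph public

Adj : (G : Graph) → Fin (size G) → Fin (size G) → Set
Adj G u v = T (edge G u v)

-- Co-normal (disjunctive) product; the vertex set Fin (n₁ * n₂) is identified
-- with Fin n₁ × Fin n₂ via the library bijection remQuot (quotient, remainder).
∨-comm : ∀ a b → (a ∨ b) ≡ (b ∨ a)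
∨-comm false false = _≡_.refl
∨-comm false true  = _≡_.refl
∨-comm true  false = _≡_.refl
∨-comm true  true  = _≡_.refl

conormal : Graph → Graph → Graph
conormal G₁ G₂ = record
  { size = size G₁ * size G₂
  ; edge = λ x y → edge G₁ (quotient (size G₂) x) (quotient (size G₂) y)
                 ∨ edge G₂ (remainder {size G₁} (size G₂) x) (remainder {size G₁} (size G₂) y)
  ; sym = λ x y → cong₂' (sym G₁ _ _) (sym G₂ _ _)
  ; irrefl = λ x → irr (irrefl G₁ _) (irrefl G₂ _)
  }
  where
  cong₂' : ∀ {a b c d : Bool} → a ≡ b → c ≡ d → (a ∨ c) ≡ (b ∨ d)
  cong₂' _≡_.refl _≡_.refl = _≡_.refl
  irr : ∀ {a b : Bool} → a ≡ false → b ≡ false → (a ∨ b) ≡ false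
  irr _≡_.refl _≡_.refl = _≡_.refl

-- An ordering of V(G): vertex v is placed at position ord v; ord is injective
-- (hence a bijection Fin n → Fin n).
Ordering : Graph → Set
Ordering G = Σ (Fin (size G) → Fin (size G)) Injective'
  where
  Injective' : (Fin (size G) → Fin (size G)) → Set
  Injective' f = Injective _≡_ _≡_ f

_before_ : ∀ {G : Graph} → Ordering G → Fin (size G) → Fin (size G) → Set
_before_ {G} (ord , _) u v = toℕ (ord u) < toℕ (ord v)

-- A partition of V(G) into (at most) k classes, given by a class map.
Partition : Graph → ℕ → Set
Partition G k = Fin (size G) → Fin k

Consistent : (G : Graph) {k : ℕ} → Ordering G → Partition G k → Set
Consistent G o c = ∀ r s t → _before_ {G} o r s → _before_ {G} o s t →
  c r ≡ c s → Adj G t r → Adj G t s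

StronglyConsistent : (G : Graph) {k : ℕ} → Ordering G → Partition G k → Set
StronglyConsistent G o c = Consistent G o c ×
  (∀ r s t → _before_ {G} o r s → _before_ {G} o s t →
     c s ≡ c t → Adj G t r → Adj G s r)

IndependentClasses : (G : Graph) {k : ℕ} → Partition G k → Set
IndependentClasses G c = ∀ u v → c u ≡ c v → Adj G u v → Data.Empty.⊥
  where import Data.Empty

ThinWith : Graph → ℕ → Set
ThinWith G k = Σ (Ordering G) λ o → Σ (Partition G k) λ c → Consistent G o c

PThinWith : Graph → ℕ → Set
PThinWith G k = Σ (Ordering G) λ o → Σ (Partition G k) λ c → StronglyConsistent G o c

IndThinWith : Graph → ℕ → Set
IndThinWith G k = Σ (Ordering G) λ o → Σ (Partition G k) λ c →
  Consistent G o c × IndependentClasses G c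

IndPThinWith : Graph → ℕ → Set
IndPThinWith G k = Σ (Ordering G) λ o → Σ (Partition G k) λ c →
  StronglyConsistent G o c × IndependentClasses G c

Colouring : Graph → ℕ → Set
Colouring G k = Σ (Fin (size G) → Fin k) λ c → IndependentClasses G c

IsMin : (ℕ → Set) → ℕ → Set
IsMin P m = P m × (∀ k → P k → m ≤ k)

IsThin IsPThin IsIndThin IsIndPThin IsChromatic : Graph → ℕ → Set
IsThin G = IsMin (ThinWith G)
IsPThin G = IsMin (PThinWith G)
IsIndThin G = IsMin (IndThinWith G)
IsIndPThin G = IsMin (IndPThinWith G)
IsChromatic G = IsMin (Colouring G)

module Submission where

-- The six inequalities come from three constructions.
--  (1) Forgetting independence turns an independent (strongly) consistent
--      partition into an ordinary one, so thin ≤ indthin and pthin ≤ indpthin.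
--  (2) Refining a (strongly) consistent partition keeps it (strongly)
--      consistent; refining by a proper colouring makes every class
--      independent.  Hence indthin(G) ≤ thin(G)·χ(G), likewise for pthin.
--  (3) For G₁ ∗ G₂, order the vertices (u, w) lexicographically following a
--      given ordering of G₁, and put (u, w), (u', w') in the same class iff
--      u, u' share a class of an independent (strongly) consistent partition
--      of G₁ and w = w'.  This is again independent and (strongly)
--      consistent, with k·|V₂| classes, so indthin(G₁ ∗ G₂) ≤ indthin(G₁)·|V₂|.

open import Defs hiding (sym)
open import Data.Nat using (ℕ; _*_; _≤_)
open import Data.Nat.Properties using (*-monoˡ-≤)
open import Data.Product using (_×_; _,_; proj₁; proj₂)
open import Data.Sum using (_⊎_; inj₁; inj₂)
open import Data.Empty using (⊥-elim)
open import Data.Bool using (T)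
open import Data.Bool.Properties using (T-∨)
open import Data.Fin using (Fin; quotient; remainder; combine)
open import Data.Fin.Properties
  using (<-cmp; <-asym; combine-injective; combine-injectiveˡ; combine-injectiveʳ;
         combine-monoˡ-<; combine-remQuot)
open import Function.Bundles using (Equivalence)
open import Relation.Binary.Definitions using (tri<; tri≈; tri>)
open import Relation.Binary.PropositionalEquality
  using (_≡_; sym; trans; cong₂; subst)

min-mono : {P Q : ℕ → Set} {m n : ℕ} →
           (∀ k → Q k → P k) → IsMin P m → IsMin Q n → m ≤ n
min-mono Q⇒P (_ , m-least) (Qn , _) = m-least _ (Q⇒P _ Qn)

indThin⇒thin : (G : Graph) (k : ℕ) → IndThinWith G k → ThinWith G k
indThin⇒thin G k (o , c , cons , _) = o , c , cons

indPThin⇒pThin : (G : Graph) (k : ℕ) → IndPThinWith G k → PThinWith G k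
indPThin⇒pThin G k (o , c , scons , _) = o , c , scons

Refines : (G : Graph) {k k' : ℕ} → Partition G k' → Partition G k → Set
Refines G c' c = ∀ u v → c' u ≡ c' v → c u ≡ c v

-- Both consistency conditions only use "same class" as a hypothesis,
-- so they pass to refinements.
consistent-refine : (G : Graph) {k k' : ℕ} (o : Ordering G)
  (c : Partition G k) (c' : Partition G k') →
  Refines G c' c → Consistent G o c → Consistent G o c'
consistent-refine G o c c' c'⊑c cons r s t r<s s<t same =
  cons r s t r<s s<t (c'⊑c r s same)

stronglyConsistent-refine : (G : Graph) {k k' : ℕ} (o : Ordering G)
  (c : Partition G k) (c' : Partition G k') →
  Refines G c' c → StronglyConsistent G o c → StronglyConsistent G o c'
stronglyConsistent-refine G o c c' c'⊑c (cons , scons) =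
  consistent-refine G o c c' c'⊑c cons ,
  λ r s t r<s s<t same → scons r s t r<s s<t (c'⊑c s t same)

refineBy : (G : Graph) {t χ : ℕ} → Partition G t → Partition G χ → Partition G (t * χ)
refineBy G c col v = combine (c v) (col v)

refineBy-refines : (G : Graph) {t χ : ℕ} (c : Partition G t) (col : Partition G χ) →
  Refines G (refineBy G c col) c
refineBy-refines G c col u v same = combine-injectiveˡ (c u) (col u) (c v) (col v) same

refineBy-independent : (G : Graph) {t χ : ℕ} (c : Partition G t) (col : Colouring G χ) →
  IndependentClasses G (refineBy G c (proj₁ col))
refineBy-independent G c (col , proper) u v same =
  proper u v (combine-injectiveʳ (c u) (col u) (c v) (col v) same)

thin⇒indThin : (G : Graph) {t χ : ℕ} → Colouring G χ →
  ThinWith G t → IndThinWith G (t * χ)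
thin⇒indThin G col (o , c , cons) =
  o , refineBy G c (proj₁ col) ,
  consistent-refine G o c _ (refineBy-refines G c (proj₁ col)) cons ,
  refineBy-independent G c col

pThin⇒indPThin : (G : Graph) {t χ : ℕ} → Colouring G χ →
  PThinWith G t → IndPThinWith G (t * χ)
pThin⇒indPThin G col (o , c , scons) =
  o , refineBy G c (proj₁ col) ,
  stronglyConsistent-refine G o c _ (refineBy-refines G c (proj₁ col)) scons ,
  refineBy-independent G c col

module CoNormal (G₁ G₂ : Graph) where

  P : Graph
  P = conormal G₁ G₂

  V : Set
  V = Fin (size P)

  π₁ : V → Fin (size G₁)
  π₁ = quotient (size G₂)

  π₂ : V → Fin (size G₂)
  π₂ = remainder {size G₁} (size G₂)

  coordinates-injective : ∀ {x y} → π₁ x ≡ π₁ y → π₂ x ≡ π₂ y → x ≡ y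
  coordinates-injective {x} {y} e₁ e₂ =
    trans (sym (combine-remQuot {size G₁} (size G₂) x))
          (trans (cong₂ combine e₁ e₂) (combine-remQuot {size G₁} (size G₂) y))

  adj-cases : ∀ x y → Adj P x y → Adj G₁ (π₁ x) (π₁ y) ⊎ Adj G₂ (π₂ x) (π₂ y)
  adj-cases x y = Equivalence.to T-∨

  adj-via₁ : ∀ x y → Adj G₁ (π₁ x) (π₁ y) → Adj P x y
  adj-via₁ x y e = Equivalence.from T-∨ (inj₁ e)

  adj-via₂ : ∀ x y → Adj G₂ (π₂ x) (π₂ y) → Adj P x y
  adj-via₂ x y e = Equivalence.from T-∨ (inj₂ e)

  lexOrdering : Ordering G₁ → Ordering P
  lexOrdering (ord , ord-inj) = lexPos , lexPos-injective
    where
    lexPos : V → V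
    lexPos x = combine (ord (π₁ x)) (π₂ x)

    lexPos-injective : ∀ {x y} → lexPos x ≡ lexPos y → x ≡ y
    lexPos-injective {x} {y} e with combine-injective _ (π₂ x) _ (π₂ y) e
    ... | e₁ , e₂ = coordinates-injective (ord-inj e₁) e₂

  lex-before : (o : Ordering G₁) (x y : V) → _before_ {P} (lexOrdering o) x y →
    π₁ x ≡ π₁ y ⊎ _before_ {G₁} o (π₁ x) (π₁ y)
  lex-before (ord , ord-inj) x y x<y with <-cmp (ord (π₁ x)) (ord (π₁ y))
  ... | tri< lt _ _ = inj₂ lt
  ... | tri≈ _ eq _ = inj₁ (ord-inj eq)
  ... | tri> _ _ gt = ⊥-elim (<-asym x<y (combine-monoˡ-< (π₂ y) (π₂ x) gt))

  liftPartition : {k : ℕ} → Partition G₁ k → Partition P (k * size G₂)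
  liftPartition c x = combine (c (π₁ x)) (π₂ x)

  lift-same-class : {k : ℕ} (c : Partition G₁ k) (x y : V) →
    liftPartition c x ≡ liftPartition c y → c (π₁ x) ≡ c (π₁ y) × π₂ x ≡ π₂ y
  lift-same-class c x y = combine-injective (c (π₁ x)) (π₂ x) (c (π₁ y)) (π₂ y)

  -- Same class forces equal second coordinates (excluding G₂-edges) and
  -- first coordinates in one independent class (excluding G₁-edges).
  lift-independent : {k : ℕ} (c : Partition G₁ k) → IndependentClasses G₁ c →
    IndependentClasses P (liftPartition c)
  lift-independent c ind x y same adj with lift-same-class c x y same
  ... | same₁ , eq₂ with adj-cases x y adj
  ... | inj₁ e₁ = ind (π₁ x) (π₁ y) same₁ e₁
  ... | inj₂ e₂ = subst T (irrefl G₂ (π₂ y)) (subst (λ w → Adj G₂ w (π₂ y)) eq₂ e₂)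

  -- A G₂-edge
  -- transfers since π₂ r = π₂ s.  For a G₁-edge: if π₁ r = π₁ s it transfers;
  -- otherwise π₁ s = π₁ t would make t ~ r an edge inside a class; so
  -- π₁ r, π₁ s, π₁ t are strictly ordered and consistency of c applies.
  lift-consistent : {k : ℕ} (o : Ordering G₁) (c : Partition G₁ k) →
    Consistent G₁ o c → IndependentClasses G₁ c →
    Consistent P (lexOrdering o) (liftPartition c)
  lift-consistent o c cons ind r s t r<s s<t same adj
    with lift-same-class c r s same | adj-cases t r adj
  ... | _ , eq₂ | inj₂ e₂ = adj-via₂ t s (subst (Adj G₂ (π₂ t)) eq₂ e₂)
  ... | same₁ , _ | inj₁ e₁ with lex-before o r s r<s
  ... | inj₁ eq₁ = adj-via₁ t s (subst (Adj G₁ (π₁ t)) eq₁ e₁)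
  ... | inj₂ r<s₁ with lex-before o s t s<t
  ... | inj₁ eq₁ = ⊥-elim (ind (π₁ s) (π₁ r) (sym same₁)
                              (subst (λ u → Adj G₁ u (π₁ r)) (sym eq₁) e₁))
  ... | inj₂ s<t₁ = adj-via₁ t s (cons (π₁ r) (π₁ s) (π₁ t) r<s₁ s<t₁ same₁ e₁)

  -- The second condition, for r < s < t with s, t in one class and t ~ r,
  -- is symmetric: now π₁ r = π₁ s would make t ~ r an edge inside a class.
  lift-strongly-consistent : {k : ℕ} (o : Ordering G₁) (c : Partition G₁ k) →
    StronglyConsistent G₁ o c → IndependentClasses G₁ c →
    StronglyConsistent P (lexOrdering o) (liftPartition c)
  lift-strongly-consistent o c (cons , scons) ind =
    lift-consistent o c cons ind , backward
    where
    backward : ∀ r s t → _before_ {P} (lexOrdering o) r s →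
      _before_ {P} (lexOrdering o) s t →
      liftPartition c s ≡ liftPartition c t → Adj P t r → Adj P s r
    backward r s t r<s s<t same adj
      with lift-same-class c s t same | adj-cases t r adj
    ... | _ , eq₂ | inj₂ e₂ = adj-via₂ s r (subst (λ w → Adj G₂ w (π₂ r)) (sym eq₂) e₂)
    ... | same₁ , _ | inj₁ e₁ with lex-before o s t s<t
    ... | inj₁ eq₁ = adj-via₁ s r (subst (λ u → Adj G₁ u (π₁ r)) (sym eq₁) e₁)
    ... | inj₂ s<t₁ with lex-before o r s r<s
    ... | inj₁ eq₁ = ⊥-elim (ind (π₁ t) (π₁ s) (sym same₁)
                                (subst (Adj G₁ (π₁ t)) eq₁ e₁))
    ... | inj₂ r<s₁ = adj-via₁ s r (scons (π₁ r) (π₁ s) (π₁ t) r<s₁ s<t₁ same₁ e₁)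

  indThin-product : (k : ℕ) → IndThinWith G₁ k → IndThinWith P (k * size G₂)
  indThin-product k (o , c , cons , ind) =
    lexOrdering o , liftPartition c , lift-consistent o c cons ind , lift-independent c ind

  indPThin-product : (k : ℕ) → IndPThinWith G₁ k → IndPThinWith P (k * size G₂)
  indPThin-product k (o , c , scons , ind) =
    lexOrdering o , liftPartition c , lift-strongly-consistent o c scons ind ,
    lift-independent c ind

theorem4p41 : (G₁ G₂ : Graph) →
    (t₁ p₁ it₁ ip₁ χ₁ t ip it pp : ℕ) →
    IsThin G₁ t₁ → IsPThin G₁ p₁ → IsIndThin G₁ it₁ → IsIndPThin G₁ ip₁ →
    IsChromatic G₁ χ₁ →
    IsThin (conormal G₁ G₂) t → IsIndThin (conormal G₁ G₂) it →
    IsPThin (conormal G₁ G₂) pp → IsIndPThin (conormal G₁ G₂) ip →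
    ((t ≤ it) × (it ≤ it₁ * size G₂) × (it₁ * size G₂ ≤ t₁ * χ₁ * size G₂))
    × ((pp ≤ ip) × (ip ≤ ip₁ * size G₂) × (ip₁ * size G₂ ≤ p₁ * χ₁ * size G₂))
theorem4p41 G₁ G₂ t₁ p₁ it₁ ip₁ χ₁ t ip it pp
  thin₁ pthin₁ indthin₁ indpthin₁ (colouring , _) thin indthin pthin indpthin =
  ( min-mono (indThin⇒thin P) thin indthin
  , proj₂ indthin _ (indThin-product it₁ (proj₁ indthin₁))
  , *-monoˡ-≤ (size G₂) (proj₂ indthin₁ _ (thin⇒indThin G₁ colouring (proj₁ thin₁))) )
  , ( min-mono (indPThin⇒pThin P) pthin indpthin
  , proj₂ indpthin _ (indPThin-product ip₁ (proj₁ indpthin₁))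
  , *-monoˡ-≤ (size G₂) (proj₂ indpthin₁ _ (pThin⇒indPThin G₁ colouring (proj₁ pthin₁))) )
  where open CoNormal G₁ G₂
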